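{- Let $t,t'$ be terms and $\pi'$ a derivation with conclusion $\Gamma\vdash t'\colon Q$. (1) If $t\to_{\beta_v}t'$ then there is a derivation $\pi$ with conclusion $\Gamma\vdash t\colon Q$ such that $|\pi|\ge|\pi'|$. (2) If $t\to_{\sigma}t'$ then there is a derivation $\pi$ with conclusion $\Gamma\vdash t\colon Q$ such that $|\pi|=|\pi'|$.
   Context: Terms: $t ::= x \mid \lambda x.t \mid tu$ (up to $\alpha$); values $v ::= x \mid \lambda x.t$; $\mathrm{Fv}(t)$ free variables; $t\{v/x\}$ substitution. Root steps: ($\beta_v$) $(\lambda x.t)v \mapsto t\{v/x\}$, $v$ a value; ($\sigma_1$) $(\lambda x.t)us \mapsto (\lambda x.ts)u$ if $x\notin\mathrm{Fv}(s)$; ($\sigma_3$) $v((\lambda x.s)u)\mapsto(\lambda x.vs)u$ if $v$ a value, $x\notin\mathrm{Fv}(v)$. $\to_{\beta_v}$ is the closure of the $\beta_v$ root step under arbitrary contexts (including under $\lambda$); $\to_\sigma$ is the closure of the union of the $\sigma_1$ and $\sigma_3$ root steps under arbitrary contexts. Types: positive types are finite multisets $[(P_1,Q_1),\dots,(P_n,Q_n)]$ of pairs of positive types ($\mathbf{0}$ empty, $\uplus$ union). Environments map variables to positive types (finitely many non-$\mathbf{0}$), combined pointwise by $\uplus$. Rules: (ax) $x\colon P\vdash x\colon P$; ($\lambda$) from $\Gamma_i,x\colon P_i\vdash t\colon Q_i$ ($1\le i\le n$, $n\ge0$) infer $\biguplus_i\Gamma_i\vdash\lambda x.t\colon[(P_1,Q_1),\dots,(P_n,Q_n)]$;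 ($@$) from $\Gamma\vdash t\colon[(P,Q)]$ and $\Delta\vdash u\colon P$ infer $\Gamma\uplus\Delta\vdash tu\colon Q$. The size $|\pi|$ of a derivation is the number of $@$ rules in it. -}

module Defs where

open import Data.Nat using (ℕ; zero; suc; _+_)
open import Data.Fin using (Fin; zero; suc)
open import Data.List using (List; []; _∷_; _++_)
open import Data.Vec using (Vec; []; _∷_; zipWith; replicate; _[_]≔_)
open import Data.Product using (_×_; _,_)

-- Terms (scoped de Bruijn syntax, so terms are taken up to α)

data Term (n : ℕ) : Set where
  var : Fin n → Term n
  ƛ   : Term (suc n) → Term n
  _·_ : Term n → Term n → Term n

infixl 7 _·_

data Value {n : ℕ} : Term n → Set where
  var : (x : Fin n) → Value (var x)
  ƛ   : (t : Term (suc n)) → Value (ƛ t)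

ext : ∀ {m n} → (Fin m → Fin n) → Fin (suc m) → Fin (suc n)
ext ρ zero    = zero
ext ρ (suc i) = suc (ρ i)

rename : ∀ {m n} → (Fin m → Fin n) → Term m → Term n
rename ρ (var x) = var (ρ x)
rename ρ (ƛ t)   = ƛ (rename (ext ρ) t)
rename ρ (t · u) = rename ρ t · rename ρ u

shift : ∀ {n} → Term n → Term (suc n)
shift = rename suc

exts : ∀ {m n} → (Fin m → Term n) → Fin (suc m) → Term (suc n)
exts σ zero    = var zero
exts σ (suc i) = shift (σ i)

subst : ∀ {m n} → (Fin m → Term n) → Term m → Term n
subst σ (var x) = σ x
subst σ (ƛ t)   = ƛ (subst (exts σ) t)
subst σ (t · u) = subst σ t · subst σ u

-- t{v/x} where x is the variable bound by the enclosing λ (index 0)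
_[_] : ∀ {n} → Term (suc n) → Term n → Term n
t [ v ] = subst σ t
  where
  σ : Fin (suc _) → Term _
  σ zero    = v
  σ (suc i) = var i

data _↦βv_ {n : ℕ} : Term n → Term n → Set where
  βv : ∀ {t : Term (suc n)} {v : Term n} → Value v → (ƛ t · v) ↦βv (t [ v ])

data _↦σ_ {n : ℕ} : Term n → Term n → Set where
  -- (λx.t)us ↦ (λx.ts)u   (x ∉ Fv(s): s lives outside the binder)
  σ₁ : ∀ {t : Term (suc n)} {u s : Term n} →
       (ƛ t · u · s) ↦σ (ƛ (t · shift s) · u)
  -- v((λx.s)u) ↦ (λx.vs)u  (x ∉ Fv(v))
  σ₃ : ∀ {v u : Term n} {s : Term (suc n)} → Value v →
       (v · (ƛ s · u)) ↦σ (ƛ (shift v · s) · u)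

data Closure (R : ∀ {n} → Term n → Term n → Set) : ∀ {n} → Term n → Term n → Set where
  root : ∀ {n} {t t' : Term n} → R t t' → Closure R t t'
  lam  : ∀ {n} {t t' : Term (suc n)} → Closure R t t' → Closure R (ƛ t) (ƛ t')
  appL : ∀ {n} {t t' u : Term n} → Closure R t t' → Closure R (t · u) (t' · u)
  appR : ∀ {n} {t u u' : Term n} → Closure R u u' → Closure R (t · u) (t · u')

_→βv_ : ∀ {n} → Term n → Term n → Set
_→βv_ = Closure _↦βv_

_→σ_ : ∀ {n} → Term n → Term n → Set
_→σ_ = Closure _↦σ_

-- Positive types: finite multisets of pairs of positive types.
-- Represented by lists, identified up to the bag equivalence _≈_ below.

data Ty : Set where
  mk : List (Ty × Ty) → Ty

𝟎 : Ty
𝟎 = mk []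

_⊎ᵗ_ : Ty → Ty → Ty
mk xs ⊎ᵗ mk ys = mk (xs ++ ys)

mutual
  data _≈_ : Ty → Ty → Set where
    mk : ∀ {xs ys} → xs ≈ₗ ys → mk xs ≈ mk ys

  data _≈ₗ_ : List (Ty × Ty) → List (Ty × Ty) → Set where
    []    : [] ≈ₗ []
    cons  : ∀ {P P' Q Q' xs ys} → P ≈ P' → Q ≈ Q' → xs ≈ₗ ys →
            ((P , Q) ∷ xs) ≈ₗ ((P' , Q') ∷ ys)
    swap  : ∀ {x y xs} → (x ∷ y ∷ xs) ≈ₗ (y ∷ x ∷ xs)
    trans : ∀ {xs ys zs} → xs ≈ₗ ys → ys ≈ₗ zs → xs ≈ₗ zs

-- Environments over the n variables in scope (all others are 𝟎)
Env : ℕ → Set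
Env n = Vec Ty n

𝟎ᴱ : ∀ {n} → Env n
𝟎ᴱ = replicate _ 𝟎

_⊎ᴱ_ : ∀ {n} → Env n → Env n → Env n
_⊎ᴱ_ = zipWith _⊎ᵗ_

_∶=_ : ∀ {n} → Fin n → Ty → Env n
x ∶= P = 𝟎ᴱ [ x ]≔ P

data _≈ᴱ_ : ∀ {n} → Env n → Env n → Set where
  []  : [] ≈ᴱ []
  _∷_ : ∀ {n P P'} {Γ Γ' : Env n} → P ≈ P' → Γ ≈ᴱ Γ' → (P ∷ Γ) ≈ᴱ (P' ∷ Γ')

-- Since types/environments are multisets, represented
-- by lists, the rule `conv` only changes the chosen representatives
-- (it is the identity on multisets) and is not counted in the size.

infix 4 _⊢_∶_

mutual
  data _⊢_∶_ {n : ℕ} : Env n → Term n → Ty → Set where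
    ax   : (x : Fin n) (P : Ty) → (x ∶= P) ⊢ var x ∶ P
    lam  : ∀ {Γ t ps} → LamPremises Γ t ps → Γ ⊢ ƛ t ∶ mk ps
    app  : ∀ {Γ Δ t u P Q} → Γ ⊢ t ∶ mk ((P , Q) ∷ []) → Δ ⊢ u ∶ P →
           (Γ ⊎ᴱ Δ) ⊢ t · u ∶ Q
    conv : ∀ {Γ Γ' t Q Q'} → Γ ≈ᴱ Γ' → Q ≈ Q' → Γ ⊢ t ∶ Q → Γ' ⊢ t ∶ Q'

  -- the n ≥ 0 premises Γᵢ, x : Pᵢ ⊢ t : Qᵢ of the (λ) rule,
  -- with conclusion environment ⊎ᵢ Γᵢ and type [(P₁,Q₁),…,(Pₙ,Qₙ)]
  data LamPremises {n : ℕ} : Env n → Term (suc n) → List (Ty × Ty) → Set where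
    []  : ∀ {t} → LamPremises 𝟎ᴱ t []
    _∷_ : ∀ {Γᵢ Γ t P Q ps} → (P ∷ Γᵢ) ⊢ t ∶ Q → LamPremises Γ t ps →
          LamPremises (Γᵢ ⊎ᴱ Γ) t ((P , Q) ∷ ps)

mutual
  size : ∀ {n} {Γ : Env n} {t Q} → Γ ⊢ t ∶ Q → ℕ
  size (ax x P)       = 0
  size (lam ps)       = sizes ps
  size (app π ρ)      = suc (size π + size ρ)
  size (conv _ _ π)   = size π

  sizes : ∀ {n} {Γ : Env n} {t ps} → LamPremises Γ t ps → ℕ
  sizes []       = 0
  sizes (π ∷ πs) = size π + sizes πs

-- For a βv-step, anti-substitution splits a
-- derivation of t{v/x} into one of t, where x gets some type P, and one of v of type P. This
-- needs v to be a value: every occurrence of v in t{v/x} is then typed by (ax) or (λ), and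
-- such derivations can be created with type 𝟎 and no (@) rule (for the occurrences that do
-- not exist) and merged along ⊎ (for the occurrences that do). The pieces recombine into a
-- derivation of (λx.t)v with one more (@) rule. A σ-step only moves a λ across an
-- application, so the premises of a derivation of the reduct re-assemble into one of the
-- redex with the same (@) rules.

module Submission where

open import Algebra.Bundles using (CommutativeMonoid)
import Algebra.Properties.CommutativeSemigroup as CommutativeSemigroupProperties
open import Data.Fin using (Fin; zero; suc)
open import Data.List using (List; []; _∷_; _++_)
open import Data.List.Properties using (++-assoc; ++-identityʳ)
open import Data.List.Relation.Binary.Permutation.Propositional as ↭ using (_↭_)
open import Data.List.Relation.Binary.Permutation.Propositional.Properties using (++-comm)
open import Data.Nat using (ℕ; zero; suc; _+_; _≤_)
open import Data.Nat.Properties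
  using (≤-refl; +-mono-≤; n<1+n; +-suc; +-identityʳ; +-assoc; +-commutativeSemigroup; module ≤-Reasoning)
open import Data.Product using (Σ; ∃; _×_; _,_; map₂)
open import Data.Vec using ([]; _∷_)
open import Function using (_∘_; id)
open import Level using (0ℓ)
open import Relation.Binary.Core using (_Preserves₂_⟶_⟶_)
open import Relation.Binary.Definitions using (Reflexive)
import Relation.Binary.PropositionalEquality as ≡
open ≡ using (_≡_; refl)

open CommutativeSemigroupProperties +-commutativeSemigroup
  using () renaming (interchange to +-interchange; xy∙z≈xz∙y to +-xy∙z≈xz∙y)

open import Defs

mutual
  ≈-refl : ∀ {P} → P ≈ P
  ≈-refl {mk _} = mk ≈ₗ-refl

  ≈ₗ-refl : ∀ {xs} → xs ≈ₗ xs
  ≈ₗ-refl {[]}          = []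
  ≈ₗ-refl {(_ , _) ∷ _} = cons ≈-refl ≈-refl ≈ₗ-refl

mutual
  ≈-sym : ∀ {P Q} → P ≈ Q → Q ≈ P
  ≈-sym (mk p) = mk (≈ₗ-sym p)

  ≈ₗ-sym : ∀ {xs ys} → xs ≈ₗ ys → ys ≈ₗ xs
  ≈ₗ-sym []           = []
  ≈ₗ-sym (cons p q r) = cons (≈-sym p) (≈-sym q) (≈ₗ-sym r)
  ≈ₗ-sym swap         = swap
  ≈ₗ-sym (trans p q)  = trans (≈ₗ-sym q) (≈ₗ-sym p)

≈-trans : ∀ {P Q R} → P ≈ Q → Q ≈ R → P ≈ R
≈-trans (mk p) (mk q) = mk (trans p q)

≈ₗ-reflexive : ∀ {xs ys} → xs ≡ ys → xs ≈ₗ ys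
≈ₗ-reflexive refl = ≈ₗ-refl

↭⇒≈ₗ : ∀ {xs ys} → xs ↭ ys → xs ≈ₗ ys
↭⇒≈ₗ ↭.refl          = ≈ₗ-refl
↭⇒≈ₗ (↭.prep _ p)    = cons ≈-refl ≈-refl (↭⇒≈ₗ p)
↭⇒≈ₗ (↭.swap _ _ p)  = trans swap (cons ≈-refl ≈-refl (cons ≈-refl ≈-refl (↭⇒≈ₗ p)))
↭⇒≈ₗ (↭.trans p q)   = trans (↭⇒≈ₗ p) (↭⇒≈ₗ q)

++⁺ˡ : ∀ {xs xs'} ys → xs ≈ₗ xs' → (xs ++ ys) ≈ₗ (xs' ++ ys)
++⁺ˡ ys []           = ≈ₗ-refl
++⁺ˡ ys (cons p q r) = cons p q (++⁺ˡ ys r)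
++⁺ˡ ys swap         = swap
++⁺ˡ ys (trans p q)  = trans (++⁺ˡ ys p) (++⁺ˡ ys q)

++⁺ʳ : ∀ xs {ys ys'} → ys ≈ₗ ys' → (xs ++ ys) ≈ₗ (xs ++ ys')
++⁺ʳ []       r = r
++⁺ʳ (_ ∷ xs) r = cons ≈-refl ≈-refl (++⁺ʳ xs r)

++⁺ : ∀ {xs xs' ys ys'} → xs ≈ₗ xs' → ys ≈ₗ ys' → (xs ++ ys) ≈ₗ (xs' ++ ys')
++⁺ {xs' = xs'} {ys = ys} p q = trans (++⁺ˡ ys p) (++⁺ʳ xs' q)

≈ₗ-[] : ∀ {xs ys} → xs ≈ₗ ys → ys ≡ [] → xs ≡ []
≈ₗ-[] []          refl = refl
≈ₗ-[] (trans p q) refl = ≈ₗ-[] p (≈ₗ-[] q refl)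

≈ₗ-[-] : ∀ {xs ys P Q} → xs ≈ₗ ys → ys ≡ (P , Q) ∷ [] →
         ∃ λ P₀ → ∃ λ Q₀ → xs ≡ (P₀ , Q₀) ∷ [] × P₀ ≈ P × Q₀ ≈ Q
≈ₗ-[-] (cons p q r) refl with ≈ₗ-[] r refl
... | refl = _ , _ , refl , p , q
≈ₗ-[-] (trans p q) e with ≈ₗ-[-] q e
... | _ , _ , e₁ , p₁ , q₁ with ≈ₗ-[-] p e₁
... | _ , _ , e₀ , p₀ , q₀ = _ , _ , e₀ , ≈-trans p₀ p₁ , ≈-trans q₀ q₁

[_⇒_] : Ty → Ty → Ty
[ P ⇒ Q ] = mk ((P , Q) ∷ [])

⇒-cong : ∀ {P P' Q Q'} → P ≈ P' → Q ≈ Q' → [ P ⇒ Q ] ≈ [ P' ⇒ Q' ]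
⇒-cong p q = mk (cons p q [])

⊎ᵗ-cong : ∀ {P P' Q Q'} → P ≈ P' → Q ≈ Q' → (P ⊎ᵗ Q) ≈ (P' ⊎ᵗ Q')
⊎ᵗ-cong (mk p) (mk q) = mk (++⁺ p q)

⊎ᵗ-comm : ∀ P Q → (P ⊎ᵗ Q) ≈ (Q ⊎ᵗ P)
⊎ᵗ-comm (mk xs) (mk ys) = mk (↭⇒≈ₗ (++-comm xs ys))

⊎ᵗ-assoc : ∀ P Q R → ((P ⊎ᵗ Q) ⊎ᵗ R) ≈ (P ⊎ᵗ (Q ⊎ᵗ R))
⊎ᵗ-assoc (mk xs) (mk ys) (mk zs) = mk (≈ₗ-reflexive (++-assoc xs ys zs))

⊎ᵗ-identityˡ : ∀ P → (𝟎 ⊎ᵗ P) ≈ P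
⊎ᵗ-identityˡ (mk _) = ≈-refl

⊎ᵗ-identityʳ : ∀ P → (P ⊎ᵗ 𝟎) ≈ P
⊎ᵗ-identityʳ (mk xs) = mk (≈ₗ-reflexive (++-identityʳ xs))

≈ᴱ-refl : ∀ {n} {Γ : Env n} → Γ ≈ᴱ Γ
≈ᴱ-refl {Γ = []}    = []
≈ᴱ-refl {Γ = _ ∷ _} = ≈-refl ∷ ≈ᴱ-refl

≈ᴱ-sym : ∀ {n} {Γ Δ : Env n} → Γ ≈ᴱ Δ → Δ ≈ᴱ Γ
≈ᴱ-sym []      = []
≈ᴱ-sym (p ∷ e) = ≈-sym p ∷ ≈ᴱ-sym e

≈ᴱ-trans : ∀ {n} {Γ Δ Θ : Env n} → Γ ≈ᴱ Δ → Δ ≈ᴱ Θ → Γ ≈ᴱ Θ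
≈ᴱ-trans []      []      = []
≈ᴱ-trans (p ∷ e) (q ∷ f) = ≈-trans p q ∷ ≈ᴱ-trans e f

≈ᴱ-head : ∀ {n P Q} {Γ Δ : Env n} → (P ∷ Γ) ≈ᴱ (Q ∷ Δ) → P ≈ Q
≈ᴱ-head (p ∷ _) = p

≈ᴱ-tail : ∀ {n P Q} {Γ Δ : Env n} → (P ∷ Γ) ≈ᴱ (Q ∷ Δ) → Γ ≈ᴱ Δ
≈ᴱ-tail (_ ∷ e) = e

⊎ᴱ-cong : ∀ {n} {Γ Γ' Δ Δ' : Env n} → Γ ≈ᴱ Γ' → Δ ≈ᴱ Δ' → (Γ ⊎ᴱ Δ) ≈ᴱ (Γ' ⊎ᴱ Δ')
⊎ᴱ-cong []      []      = []
⊎ᴱ-cong (p ∷ e) (q ∷ f) = ⊎ᵗ-cong p q ∷ ⊎ᴱ-cong e f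

⊎ᴱ-comm : ∀ {n} (Γ Δ : Env n) → (Γ ⊎ᴱ Δ) ≈ᴱ (Δ ⊎ᴱ Γ)
⊎ᴱ-comm []      []      = []
⊎ᴱ-comm (P ∷ Γ) (Q ∷ Δ) = ⊎ᵗ-comm P Q ∷ ⊎ᴱ-comm Γ Δ

⊎ᴱ-assoc : ∀ {n} (Γ Δ Θ : Env n) → ((Γ ⊎ᴱ Δ) ⊎ᴱ Θ) ≈ᴱ (Γ ⊎ᴱ (Δ ⊎ᴱ Θ))
⊎ᴱ-assoc []      []      []      = []
⊎ᴱ-assoc (P ∷ Γ) (Q ∷ Δ) (R ∷ Θ) = ⊎ᵗ-assoc P Q R ∷ ⊎ᴱ-assoc Γ Δ Θ

⊎ᴱ-identityˡ : ∀ {n} (Γ : Env n) → (𝟎ᴱ ⊎ᴱ Γ) ≈ᴱ Γ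
⊎ᴱ-identityˡ []      = []
⊎ᴱ-identityˡ (P ∷ Γ) = ⊎ᵗ-identityˡ P ∷ ⊎ᴱ-identityˡ Γ

⊎ᴱ-identityʳ : ∀ {n} (Γ : Env n) → (Γ ⊎ᴱ 𝟎ᴱ) ≈ᴱ Γ
⊎ᴱ-identityʳ []      = []
⊎ᴱ-identityʳ (P ∷ Γ) = ⊎ᵗ-identityʳ P ∷ ⊎ᴱ-identityʳ Γ

⊎ᴱ-commutativeMonoid : ℕ → CommutativeMonoid 0ℓ 0ℓ
⊎ᴱ-commutativeMonoid n = record
  { Carrier             = Env n
  ; _≈_                 = _≈ᴱ_
  ; _∙_                 = _⊎ᴱ_
  ; ε                   = 𝟎ᴱ
  ; isCommutativeMonoid = record
    { isMonoid = record
      { isSemigroup = record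
        { isMagma = record
          { isEquivalence = record { refl = ≈ᴱ-refl ; sym = ≈ᴱ-sym ; trans = ≈ᴱ-trans }
          ; ∙-cong        = ⊎ᴱ-cong
          }
        ; assoc = ⊎ᴱ-assoc
        }
      ; identity = ⊎ᴱ-identityˡ , ⊎ᴱ-identityʳ
      }
    ; comm = ⊎ᴱ-comm
    }
  }

module ⊎ᴱ-Properties {n : ℕ} =
  CommutativeSemigroupProperties (CommutativeMonoid.commutativeSemigroup (⊎ᴱ-commutativeMonoid n))

∶=-cong : ∀ {n} (x : Fin n) {P Q} → P ≈ Q → (x ∶= P) ≈ᴱ (x ∶= Q)
∶=-cong zero    p = p ∷ ≈ᴱ-refl
∶=-cong (suc x) p = ≈-refl ∷ ∶=-cong x p

∶=-𝟎 : ∀ {n} (x : Fin n) → (x ∶= 𝟎) ≈ᴱ 𝟎ᴱ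
∶=-𝟎 zero    = ≈ᴱ-refl
∶=-𝟎 (suc x) = ≈-refl ∷ ∶=-𝟎 x

∶=-⊎ : ∀ {n} (x : Fin n) P Q → (x ∶= (P ⊎ᵗ Q)) ≈ᴱ ((x ∶= P) ⊎ᴱ (x ∶= Q))
∶=-⊎ zero    P Q = ≈-refl ∷ ≈ᴱ-sym (⊎ᴱ-identityˡ 𝟎ᴱ)
∶=-⊎ (suc x) P Q = ≈-refl ∷ ∶=-⊎ x P Q

convᴱ : ∀ {n} {Γ Γ' : Env n} {t Q} → Γ ≈ᴱ Γ' → Γ ⊢ t ∶ Q → Γ' ⊢ t ∶ Q
convᴱ e = conv e ≈-refl

convʰ : ∀ {n} {Γ : Env n} {t P P' Q} → P ≈ P' → (P ∷ Γ) ⊢ t ∶ Q → (P' ∷ Γ) ⊢ t ∶ Q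
convʰ p = convᴱ (p ∷ ≈ᴱ-refl)

var-inversion : ∀ {n} {Γ : Env n} {x Q} (π : Γ ⊢ var x ∶ Q) → Γ ≈ᴱ (x ∶= Q) × size π ≡ 0
var-inversion (ax x P) = ≈ᴱ-refl , refl
var-inversion {x = x} (conv e q π) with var-inversion π
... | e' , s = ≈ᴱ-trans (≈ᴱ-sym e) (≈ᴱ-trans e' (∶=-cong x q)) , s

record LamGeneration {n} (Γ : Env n) (t : Term (suc n)) (Q : Ty) (k : ℕ) : Set where
  constructor lam-generation
  field
    ps       : List (Ty × Ty)
    Γ₀       : Env n
    premises : LamPremises Γ₀ t ps
    env      : Γ ≈ᴱ Γ₀
    type     : mk ps ≈ Q
    size≡    : k ≡ sizes premises

lam-inversion : ∀ {n} {Γ : Env n} {t Q} (π : Γ ⊢ ƛ t ∶ Q) → LamGeneration Γ t Q (size π)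
lam-inversion (lam premises) = lam-generation _ _ premises ≈ᴱ-refl ≈-refl refl
lam-inversion (conv e q π) with lam-inversion π
... | lam-generation ps Γ₀ premises env type size≡ =
  lam-generation ps Γ₀ premises (≈ᴱ-trans (≈ᴱ-sym e) env) (≈-trans type q) size≡

record AppGeneration {n} (Γ : Env n) (t u : Term n) (Q : Ty) (k : ℕ) : Set where
  constructor app-generation
  field
    Γₜ Γᵤ : Env n
    P     : Ty
    ⊢t    : Γₜ ⊢ t ∶ [ P ⇒ Q ]
    ⊢u    : Γᵤ ⊢ u ∶ P
    env   : Γ ≈ᴱ (Γₜ ⊎ᴱ Γᵤ)
    size≡ : k ≡ suc (size ⊢t + size ⊢u)

app-inversion : ∀ {n} {Γ : Env n} {t u Q} (π : Γ ⊢ t · u ∶ Q) → AppGeneration Γ t u Q (size π)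
app-inversion (app ⊢t ⊢u) = app-generation _ _ _ ⊢t ⊢u ≈ᴱ-refl refl
app-inversion (conv e q π) with app-inversion π
... | app-generation Γₜ Γᵤ P ⊢t ⊢u env size≡ =
  app-generation Γₜ Γᵤ P (conv ≈ᴱ-refl (⇒-cong ≈-refl q) ⊢t) ⊢u (≈ᴱ-trans (≈ᴱ-sym e) env) size≡

record RedexGeneration {n} (Γ : Env n) (t : Term (suc n)) (u : Term n) (Q : Ty) (k : ℕ) : Set where
  constructor redex-generation
  field
    Γₜ Γᵤ : Env n
    P     : Ty
    ⊢t    : (P ∷ Γₜ) ⊢ t ∶ Q
    ⊢u    : Γᵤ ⊢ u ∶ P
    env   : Γ ≈ᴱ (Γₜ ⊎ᴱ Γᵤ)
    size≡ : k ≡ suc (size ⊢t + size ⊢u)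

redex-inversion : ∀ {n} {Γ : Env n} {t u Q} (π : Γ ⊢ ƛ t · u ∶ Q) →
                  RedexGeneration Γ t u Q (size π)
redex-inversion π with app-inversion π
... | app-generation Γλ Γᵤ P ⊢λ ⊢u env size≡ with lam-inversion ⊢λ
... | lam-generation _ _ premises envλ (mk ps≈) size≡λ with ≈ₗ-[-] ps≈ refl
... | _ , _ , refl , p , q with premises
... | _∷_ {Γᵢ = Γₜ} ⊢t [] =
  redex-generation Γₜ Γᵤ P (conv (p ∷ ≈ᴱ-refl) q ⊢t) ⊢u
    (≈ᴱ-trans env (⊎ᴱ-cong (≈ᴱ-trans envλ (⊎ᴱ-identityʳ Γₜ)) ≈ᴱ-refl))
    (≡.trans size≡ (≡.cong (λ k → suc (k + size ⊢u)) (≡.trans size≡λ (+-identityʳ (size ⊢t)))))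

redex : ∀ {n} {Γ Γₜ Γᵤ : Env n} {t u P Q} → Γ ≈ᴱ (Γₜ ⊎ᴱ Γᵤ) →
        (⊢t : (P ∷ Γₜ) ⊢ t ∶ Q) (⊢u : Γᵤ ⊢ u ∶ P) →
        Σ (Γ ⊢ ƛ t · u ∶ Q) λ π → size π ≡ suc (size ⊢t + size ⊢u)
redex {Γₜ = Γₜ} e ⊢t ⊢u =
  convᴱ (≈ᴱ-sym (≈ᴱ-trans e (⊎ᴱ-cong (≈ᴱ-sym (⊎ᴱ-identityʳ Γₜ)) ≈ᴱ-refl))) (app (lam (⊢t ∷ [])) ⊢u) ,
  ≡.cong (λ k → suc (k + size ⊢u)) (+-identityʳ (size ⊢t))

value-𝟎 : ∀ {n} {w : Term n} → Value w → Σ (𝟎ᴱ ⊢ w ∶ 𝟎) λ π → size π ≡ 0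
value-𝟎 (var x) = convᴱ (∶=-𝟎 x) (ax x 𝟎) , refl
value-𝟎 (ƛ t)   = lam [] , refl

LamPremises-++ : ∀ {n} {Γ₁ Γ₂ : Env n} {t ps qs}
  (L₁ : LamPremises Γ₁ t ps) (L₂ : LamPremises Γ₂ t qs) →
  ∃ λ Γ → Σ (LamPremises Γ t (ps ++ qs)) λ L → Γ ≈ᴱ (Γ₁ ⊎ᴱ Γ₂) × sizes L ≡ sizes L₁ + sizes L₂
LamPremises-++ {Γ₂ = Γ₂} [] L₂ = Γ₂ , L₂ , ≈ᴱ-sym (⊎ᴱ-identityˡ Γ₂) , refl
LamPremises-++ {Γ₂ = Γ₂} (_∷_ {Γᵢ = Γᵢ} {Γ = Γ} π L₁) L₂ with LamPremises-++ L₁ L₂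
... | Γ' , L , e , s =
  Γᵢ ⊎ᴱ Γ' , π ∷ L ,
  ≈ᴱ-trans (⊎ᴱ-cong ≈ᴱ-refl e) (≈ᴱ-sym (⊎ᴱ-assoc Γᵢ Γ Γ₂)) ,
  ≡.trans (≡.cong (size π +_) s) (≡.sym (+-assoc (size π) (sizes L₁) (sizes L₂)))

value-⊎ : ∀ {n} {w : Term n} {Γ₁ Γ₂ P₁ P₂} → Value w →
  (π₁ : Γ₁ ⊢ w ∶ P₁) (π₂ : Γ₂ ⊢ w ∶ P₂) →
  Σ ((Γ₁ ⊎ᴱ Γ₂) ⊢ w ∶ (P₁ ⊎ᵗ P₂)) λ π → size π ≡ size π₁ + size π₂
value-⊎ {P₁ = P₁} {P₂} (var x) π₁ π₂ with var-inversion π₁ | var-inversion π₂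
... | e₁ , s₁ | e₂ , s₂ =
  convᴱ (≈ᴱ-trans (∶=-⊎ x P₁ P₂) (≈ᴱ-sym (⊎ᴱ-cong e₁ e₂))) (ax x (P₁ ⊎ᵗ P₂)) ,
  ≡.sym (≡.cong₂ _+_ s₁ s₂)
value-⊎ (ƛ t) π₁ π₂ with lam-inversion π₁ | lam-inversion π₂
... | lam-generation _ _ L₁ e₁ q₁ s₁ | lam-generation _ _ L₂ e₂ q₂ s₂ with LamPremises-++ L₁ L₂
... | _ , L , e , s =
  conv (≈ᴱ-trans e (≈ᴱ-sym (⊎ᴱ-cong e₁ e₂))) (⊎ᵗ-cong q₁ q₂) (lam L) ,
  ≡.trans s (≡.sym (≡.cong₂ _+_ s₁ s₂))

push : ∀ {m n} → (Fin m → Fin n) → Env m → Env n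
push ρ []      = 𝟎ᴱ
push ρ (P ∷ Δ) = (ρ zero ∶= P) ⊎ᴱ push (ρ ∘ suc) Δ

push-𝟎 : ∀ {m n} (ρ : Fin m → Fin n) → push ρ 𝟎ᴱ ≈ᴱ 𝟎ᴱ
push-𝟎 {zero}  ρ = ≈ᴱ-refl
push-𝟎 {suc m} ρ = ≈ᴱ-trans (⊎ᴱ-cong (∶=-𝟎 (ρ zero)) (push-𝟎 (ρ ∘ suc))) (⊎ᴱ-identityˡ 𝟎ᴱ)

push-∶= : ∀ {m n} (ρ : Fin m → Fin n) x P → push ρ (x ∶= P) ≈ᴱ (ρ x ∶= P)
push-∶= ρ zero    P = ≈ᴱ-trans (⊎ᴱ-cong ≈ᴱ-refl (push-𝟎 (ρ ∘ suc))) (⊎ᴱ-identityʳ _)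
push-∶= ρ (suc x) P = ≈ᴱ-trans (⊎ᴱ-cong (∶=-𝟎 (ρ zero)) (push-∶= (ρ ∘ suc) x P)) (⊎ᴱ-identityˡ _)

push-⊎ : ∀ {m n} (ρ : Fin m → Fin n) Δ₁ Δ₂ → push ρ (Δ₁ ⊎ᴱ Δ₂) ≈ᴱ (push ρ Δ₁ ⊎ᴱ push ρ Δ₂)
push-⊎ ρ []       []       = ≈ᴱ-sym (⊎ᴱ-identityˡ 𝟎ᴱ)
push-⊎ ρ (P ∷ Δ₁) (Q ∷ Δ₂) =
  ≈ᴱ-trans (⊎ᴱ-cong (∶=-⊎ (ρ zero) P Q) (push-⊎ (ρ ∘ suc) Δ₁ Δ₂)) (⊎ᴱ-Properties.interchange _ _ _ _)

push-suc : ∀ {m n} (ρ : Fin m → Fin n) Δ → push (suc ∘ ρ) Δ ≈ᴱ (𝟎 ∷ push ρ Δ)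
push-suc ρ []      = ≈ᴱ-refl
push-suc ρ (P ∷ Δ) = ⊎ᴱ-cong ≈ᴱ-refl (push-suc (ρ ∘ suc) Δ)

push-ext : ∀ {m n} (ρ : Fin m → Fin n) P Δ → push (ext ρ) (P ∷ Δ) ≈ᴱ (P ∷ push ρ Δ)
push-ext ρ P Δ =
  ≈ᴱ-trans (⊎ᴱ-cong ≈ᴱ-refl (push-suc ρ Δ)) (⊎ᵗ-identityʳ P ∷ ⊎ᴱ-identityˡ (push ρ Δ))

push-id : ∀ {m} (Δ : Env m) → push id Δ ≈ᴱ Δ
push-id []      = []
push-id (P ∷ Δ) = ≈ᴱ-trans (push-ext id P Δ) (≈-refl ∷ push-id Δ)

mutual
  anti-rename : ∀ {m n} (ρ : Fin m → Fin n) (w : Term m) {Γ P} (π : Γ ⊢ rename ρ w ∶ P) →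
    ∃ λ Δ → Σ (Δ ⊢ w ∶ P) λ π₀ → Γ ≈ᴱ push ρ Δ × size π ≡ size π₀
  anti-rename ρ (var x) {P = P} π with var-inversion π
  ... | e , s = x ∶= P , ax x P , ≈ᴱ-trans e (≈ᴱ-sym (push-∶= ρ x P)) , s
  anti-rename ρ (t · u) π with app-inversion π
  ... | app-generation _ _ _ ⊢t ⊢u env size≡ with anti-rename ρ t ⊢t | anti-rename ρ u ⊢u
  ... | Δₜ , πₜ , eₜ , sₜ | Δᵤ , πᵤ , eᵤ , sᵤ =
    Δₜ ⊎ᴱ Δᵤ , app πₜ πᵤ ,
    ≈ᴱ-trans env (≈ᴱ-trans (⊎ᴱ-cong eₜ eᵤ) (≈ᴱ-sym (push-⊎ ρ Δₜ Δᵤ))) ,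
    ≡.trans size≡ (≡.cong suc (≡.cong₂ _+_ sₜ sᵤ))
  anti-rename ρ (ƛ t) π with lam-inversion π
  ... | lam-generation _ _ premises env type size≡ with anti-renameᴸ ρ t premises
  ... | Δ , L , e , s = Δ , conv ≈ᴱ-refl type (lam L) , ≈ᴱ-trans env e , ≡.trans size≡ s

  anti-renameᴸ : ∀ {m n} (ρ : Fin m → Fin n) (t : Term (suc m)) {Γ ps}
    (L : LamPremises Γ (rename (ext ρ) t) ps) →
    ∃ λ Δ → Σ (LamPremises Δ t ps) λ L₀ → Γ ≈ᴱ push ρ Δ × sizes L ≡ sizes L₀
  anti-renameᴸ ρ t [] = 𝟎ᴱ , [] , ≈ᴱ-sym (push-𝟎 ρ) , refl
  anti-renameᴸ ρ t (π ∷ L) with anti-rename (ext ρ) t π | anti-renameᴸ ρ t L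
  ... | P ∷ Δᵢ , πᵢ , eᵢ , sᵢ | Δ , L₀ , e , s =
    let eᵢ' = ≈ᴱ-trans eᵢ (push-ext ρ P Δᵢ) in
    Δᵢ ⊎ᴱ Δ , convʰ (≈-sym (≈ᴱ-head eᵢ')) πᵢ ∷ L₀ ,
    ≈ᴱ-trans (⊎ᴱ-cong (≈ᴱ-tail eᵢ') e) (≈ᴱ-sym (push-⊎ ρ Δᵢ Δ)) ,
    ≡.cong₂ _+_ sᵢ s

anti-weaken : ∀ {n} (w : Term n) {Γ P Q} (π : (P ∷ Γ) ⊢ shift w ∶ Q) →
  P ≈ 𝟎 × Σ (Γ ⊢ w ∶ Q) λ π₀ → size π ≡ size π₀
anti-weaken w π with anti-rename suc w π
... | Δ , π₀ , e , s with ≈ᴱ-trans e (≈ᴱ-trans (push-suc id Δ) (≈-refl ∷ push-id Δ))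
... | p ∷ e' = p , convᴱ (≈ᴱ-sym e') π₀ , s

ValueSubst : ∀ {m n} → (Fin m → Term n) → Set
ValueSubst σ = ∀ i → Value (σ i)

Value-rename : ∀ {m n} (ρ : Fin m → Fin n) {w} → Value w → Value (rename ρ w)
Value-rename ρ (var x) = var (ρ x)
Value-rename ρ (ƛ t)   = ƛ _

ValueSubst-exts : ∀ {m n} {σ : Fin m → Term n} → ValueSubst σ → ValueSubst (exts σ)
ValueSubst-exts vs zero    = var zero
ValueSubst-exts vs (suc i) = Value-rename suc (vs i)

infix 4 _⊢ˢ_∶_

data _⊢ˢ_∶_ {n : ℕ} : ∀ {m} → Env n → (Fin m → Term n) → Env m → Set where
  nilˢ  : ∀ {Γ} {σ : Fin 0 → Term n} → Γ ≈ᴱ 𝟎ᴱ → Γ ⊢ˢ σ ∶ []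
  consˢ : ∀ {m Γ Γ₀ Γ₁ P Δ} {σ : Fin (suc m) → Term n} → Γ ≈ᴱ (Γ₀ ⊎ᴱ Γ₁) →
          Γ₀ ⊢ σ zero ∶ P → Γ₁ ⊢ˢ σ ∘ suc ∶ Δ → Γ ⊢ˢ σ ∶ (P ∷ Δ)

sizeˢ : ∀ {m n} {Γ : Env n} {σ : Fin m → Term n} {Δ} → Γ ⊢ˢ σ ∶ Δ → ℕ
sizeˢ (nilˢ _)      = 0
sizeˢ (consˢ _ π S) = size π + sizeˢ S

⊢ˢ-conv : ∀ {m n} {Γ Γ' : Env n} {σ : Fin m → Term n} {Δ} → Γ ≈ᴱ Γ' →
  (S : Γ ⊢ˢ σ ∶ Δ) → Σ (Γ' ⊢ˢ σ ∶ Δ) λ S' → sizeˢ S' ≡ sizeˢ S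
⊢ˢ-conv e (nilˢ e')      = nilˢ (≈ᴱ-trans (≈ᴱ-sym e) e') , refl
⊢ˢ-conv e (consˢ e' π S) = consˢ (≈ᴱ-trans (≈ᴱ-sym e) e') π S , refl

⊢ˢ-𝟎 : ∀ {m n} {σ : Fin m → Term n} → ValueSubst σ → Σ (𝟎ᴱ ⊢ˢ σ ∶ 𝟎ᴱ) λ S → sizeˢ S ≡ 0
⊢ˢ-𝟎 {zero}  vs = nilˢ ≈ᴱ-refl , refl
⊢ˢ-𝟎 {suc m} vs with value-𝟎 (vs zero) | ⊢ˢ-𝟎 (vs ∘ suc)
... | π , s | S , s' = consˢ (≈ᴱ-sym (⊎ᴱ-identityˡ 𝟎ᴱ)) π S , ≡.cong₂ _+_ s s'

⊢ˢ-∶= : ∀ {m n} {σ : Fin m → Term n} → ValueSubst σ → ∀ x {Γ Q} (π : Γ ⊢ σ x ∶ Q) →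
  Σ (Γ ⊢ˢ σ ∶ (x ∶= Q)) λ S → sizeˢ S ≡ size π
⊢ˢ-∶= vs zero {Γ} π with ⊢ˢ-𝟎 (vs ∘ suc)
... | S , s = consˢ (≈ᴱ-sym (⊎ᴱ-identityʳ Γ)) π S ,
              ≡.trans (≡.cong (size π +_) s) (+-identityʳ (size π))
⊢ˢ-∶= vs (suc x) {Γ} π with value-𝟎 (vs zero) | ⊢ˢ-∶= (vs ∘ suc) x π
... | π₀ , s | S , s' = consˢ (≈ᴱ-sym (⊎ᴱ-identityˡ Γ)) π₀ S , ≡.cong₂ _+_ s s'

⊢ˢ-⊎ : ∀ {m n} {σ : Fin m → Term n} → ValueSubst σ → ∀ {Γ Γ₁ Γ₂ Δ₁ Δ₂} → Γ ≈ᴱ (Γ₁ ⊎ᴱ Γ₂) →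
  (S₁ : Γ₁ ⊢ˢ σ ∶ Δ₁) (S₂ : Γ₂ ⊢ˢ σ ∶ Δ₂) →
  Σ (Γ ⊢ˢ σ ∶ (Δ₁ ⊎ᴱ Δ₂)) λ S → sizeˢ S ≡ sizeˢ S₁ + sizeˢ S₂
⊢ˢ-⊎ vs e (nilˢ e₁) (nilˢ e₂) =
  nilˢ (≈ᴱ-trans e (≈ᴱ-trans (⊎ᴱ-cong e₁ e₂) (⊎ᴱ-identityˡ 𝟎ᴱ))) , refl
⊢ˢ-⊎ vs e (consˢ {Γ₀ = A} {Γ₁ = A'} e₁ π₁ S₁) (consˢ {Γ₀ = B} {Γ₁ = B'} e₂ π₂ S₂)
  with value-⊎ (vs zero) π₁ π₂ | ⊢ˢ-⊎ (vs ∘ suc) ≈ᴱ-refl S₁ S₂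
... | π , s | S , s' =
  consˢ (≈ᴱ-trans e (≈ᴱ-trans (⊎ᴱ-cong e₁ e₂) (⊎ᴱ-Properties.interchange A A' B B'))) π S ,
  ≡.trans (≡.cong₂ _+_ s s') (+-interchange (size π₁) (size π₂) (sizeˢ S₁) (sizeˢ S₂))

⊢ˢ-unshift : ∀ {m n} {σ : Fin m → Term n} {P Γ Δ} (S : (P ∷ Γ) ⊢ˢ shift ∘ σ ∶ Δ) →
  P ≈ 𝟎 × Σ (Γ ⊢ˢ σ ∶ Δ) λ S' → sizeˢ S ≡ sizeˢ S'
⊢ˢ-unshift (nilˢ (p ∷ e)) = p , nilˢ e , refl
⊢ˢ-unshift {σ = σ} (consˢ {Γ₀ = _ ∷ _} {Γ₁ = _ ∷ _} (p ∷ e) π S)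
  with anti-weaken (σ zero) π | ⊢ˢ-unshift S
... | p₀ , π₀ , s | p₁ , S' , s' =
  ≈-trans p (⊎ᵗ-cong p₀ p₁) , consˢ e π₀ S' , ≡.cong₂ _+_ s s'

⊢ˢ-exts⁻¹ : ∀ {m n} {σ : Fin m → Term n} {P P' Γ Δ} (S : (P ∷ Γ) ⊢ˢ exts σ ∶ (P' ∷ Δ)) →
  P ≈ P' × Σ (Γ ⊢ˢ σ ∶ Δ) λ S' → sizeˢ S ≡ sizeˢ S'
⊢ˢ-exts⁻¹ {P' = P'} (consˢ {Γ₁ = _ ∷ Γ₁} e π S) with var-inversion π | ⊢ˢ-unshift S
... | e₀ , s₀ | p₁ , S' , s₁ with ≈ᴱ-trans e (⊎ᴱ-cong e₀ (p₁ ∷ ≈ᴱ-refl))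
... | p ∷ e' with ⊢ˢ-conv (≈ᴱ-sym (≈ᴱ-trans e' (⊎ᴱ-identityˡ Γ₁))) S'
... | S'' , s'' =
  ≈-trans p (⊎ᵗ-identityʳ P') , S'' , ≡.trans (≡.cong₂ _+_ s₀ s₁) (≡.sym s'')

⊢ˢ-var : ∀ {m n} (ρ : Fin m → Fin n) {Γ Δ} (S : Γ ⊢ˢ var ∘ ρ ∶ Δ) →
  Γ ≈ᴱ push ρ Δ × sizeˢ S ≡ 0
⊢ˢ-var ρ (nilˢ e) = e , refl
⊢ˢ-var ρ (consˢ e π S) with var-inversion π | ⊢ˢ-var (ρ ∘ suc) S
... | e₀ , s₀ | e₁ , s₁ = ≈ᴱ-trans e (⊎ᴱ-cong e₀ e₁) , ≡.cong₂ _+_ s₀ s₁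

mutual
  anti-subst : ∀ {m n} {σ : Fin m → Term n} → ValueSubst σ → ∀ (t : Term m) {Γ Q}
    (π : Γ ⊢ subst σ t ∶ Q) →
    ∃ λ Δ → Σ (Δ ⊢ t ∶ Q) λ π₀ → Σ (Γ ⊢ˢ σ ∶ Δ) λ S → size π ≡ size π₀ + sizeˢ S
  anti-subst vs (var x) {Q = Q} π with ⊢ˢ-∶= vs x π
  ... | S , s = x ∶= Q , ax x Q , S , ≡.sym s
  anti-subst vs (t · u) π with app-inversion π
  ... | app-generation _ _ _ ⊢t ⊢u env size≡ with anti-subst vs t ⊢t | anti-subst vs u ⊢u
  ... | Δₜ , πₜ , Sₜ , sₜ | Δᵤ , πᵤ , Sᵤ , sᵤ with ⊢ˢ-⊎ vs env Sₜ Sᵤ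
  ... | S , s = Δₜ ⊎ᴱ Δᵤ , app πₜ πᵤ , S , (begin
    size π                                                  ≡⟨ size≡ ⟩
    suc (size ⊢t + size ⊢u)                                 ≡⟨ ≡.cong suc (≡.cong₂ _+_ sₜ sᵤ) ⟩
    suc ((size πₜ + sizeˢ Sₜ) + (size πᵤ + sizeˢ Sᵤ))     ≡⟨ ≡.cong suc (+-interchange (size πₜ) (sizeˢ Sₜ) (size πᵤ) (sizeˢ Sᵤ)) ⟩
    suc ((size πₜ + size πᵤ) + (sizeˢ Sₜ + sizeˢ Sᵤ))     ≡⟨ ≡.cong (λ k → suc (size πₜ + size πᵤ + k)) (≡.sym s) ⟩
    suc (size πₜ + size πᵤ) + sizeˢ S                      ∎)
    where open ≡.≡-Reasoning
  anti-subst vs (ƛ t) π with lam-inversion π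
  ... | lam-generation _ _ premises env type size≡ with anti-substᴸ vs t premises
  ... | Δ , L , S , s with ⊢ˢ-conv (≈ᴱ-sym env) S
  ... | S' , s' = Δ , conv ≈ᴱ-refl type (lam L) , S' ,
                  ≡.trans size≡ (≡.trans s (≡.cong (sizes L +_) (≡.sym s')))

  anti-substᴸ : ∀ {m n} {σ : Fin m → Term n} → ValueSubst σ → ∀ (t : Term (suc m)) {Γ ps}
    (L : LamPremises Γ (subst (exts σ) t) ps) →
    ∃ λ Δ → Σ (LamPremises Δ t ps) λ L₀ → Σ (Γ ⊢ˢ σ ∶ Δ) λ S → sizes L ≡ sizes L₀ + sizeˢ S
  anti-substᴸ vs t [] with ⊢ˢ-𝟎 vs
  ... | S , s = 𝟎ᴱ , [] , S , ≡.sym s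
  anti-substᴸ vs t (π ∷ L) with anti-subst (ValueSubst-exts vs) t π | anti-substᴸ vs t L
  ... | _ ∷ Δᵢ , πᵢ , Sᵢ , sᵢ | Δ , L₀ , S , s with ⊢ˢ-exts⁻¹ Sᵢ
  ... | p , Sᵢ' , sᵢ' with ⊢ˢ-⊎ vs ≈ᴱ-refl Sᵢ' S
  ... | S' , s' = Δᵢ ⊎ᴱ Δ , convʰ (≈-sym p) πᵢ ∷ L₀ , S' , (begin
    size π + sizes L                                         ≡⟨ ≡.cong₂ _+_ sᵢ s ⟩
    (size πᵢ + sizeˢ Sᵢ) + (sizes L₀ + sizeˢ S)             ≡⟨ ≡.cong (λ k → (size πᵢ + k) + _) sᵢ' ⟩
    (size πᵢ + sizeˢ Sᵢ') + (sizes L₀ + sizeˢ S)            ≡⟨ +-interchange (size πᵢ) (sizeˢ Sᵢ') (sizes L₀) (sizeˢ S) ⟩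
    (size πᵢ + sizes L₀) + (sizeˢ Sᵢ' + sizeˢ S)            ≡⟨ ≡.cong (size πᵢ + sizes L₀ +_) (≡.sym s') ⟩
    (size πᵢ + sizes L₀) + sizeˢ S'                          ∎)
    where open ≡.≡-Reasoning

βv-root-expansion : ∀ {n} {t t' : Term n} → t ↦βv t' → ∀ {Γ Q} (π' : Γ ⊢ t' ∶ Q) →
  Σ (Γ ⊢ t ∶ Q) λ π → size π' ≤ size π
βv-root-expansion (βv {t} {v} value) π'
  with anti-subst (λ { zero → value ; (suc i) → var i }) t π'
... | P ∷ Δ , πₜ , consˢ {Γ₀ = Γᵥ} e πᵥ S , s with ⊢ˢ-var id S
... | eₛ , sₛ with redex (≈ᴱ-trans e (≈ᴱ-trans (⊎ᴱ-cong ≈ᴱ-refl (≈ᴱ-trans eₛ (push-id Δ))) (⊎ᴱ-comm Γᵥ Δ))) πₜ πᵥ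
... | π , sπ = π , (begin
  size π'                              ≡⟨ s ⟩
  size πₜ + (size πᵥ + sizeˢ S)        ≡⟨ ≡.cong (λ k → size πₜ + (size πᵥ + k)) sₛ ⟩
  size πₜ + (size πᵥ + 0)              ≡⟨ ≡.cong (size πₜ +_) (+-identityʳ (size πᵥ)) ⟩
  size πₜ + size πᵥ                    <⟨ n<1+n _ ⟩
  suc (size πₜ + size πᵥ)              ≡⟨ ≡.sym sπ ⟩
  size π                               ∎)
  where open ≤-Reasoning

σ-root-expansion : ∀ {n} {t t' : Term n} → t ↦σ t' → ∀ {Γ Q} (π' : Γ ⊢ t' ∶ Q) →
  Σ (Γ ⊢ t ∶ Q) λ π → size π' ≡ size π
σ-root-expansion (σ₁ {s = s}) π' with redex-inversion π'
... | redex-generation Γₜ Γᵤ P ⊢ts ⊢u env size≡ with app-inversion ⊢ts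
... | app-generation (Pₜ ∷ Γ₁) (Pₛ ∷ Γₛ) R ⊢t ⊢shift-s (p ∷ e) size≡ₜₛ
  with anti-weaken s ⊢shift-s
... | pₛ , ⊢s , sₛ
  with redex ≈ᴱ-refl (convʰ (≈-sym (≈-trans p (≈-trans (⊎ᵗ-cong ≈-refl pₛ) (⊎ᵗ-identityʳ Pₜ)))) ⊢t) ⊢u
... | ⊢redex , sᵣ =
  convᴱ (≈ᴱ-sym (≈ᴱ-trans env (≈ᴱ-trans (⊎ᴱ-cong e ≈ᴱ-refl) (⊎ᴱ-Properties.xy∙z≈xz∙y Γ₁ Γₛ Γᵤ))))
        (app ⊢redex ⊢s) , (begin
  size π'                                        ≡⟨ size≡ ⟩
  suc (size ⊢ts + size ⊢u)                       ≡⟨ ≡.cong (λ k → suc (k + size ⊢u)) size≡ₜₛ ⟩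
  suc (suc (size ⊢t + size ⊢shift-s) + size ⊢u)  ≡⟨ ≡.cong (λ k → suc (suc (size ⊢t + k) + size ⊢u)) sₛ ⟩
  suc (suc (size ⊢t + size ⊢s) + size ⊢u)        ≡⟨ ≡.cong (λ k → suc (suc k)) (+-xy∙z≈xz∙y (size ⊢t) (size ⊢s) (size ⊢u)) ⟩
  suc (suc (size ⊢t + size ⊢u) + size ⊢s)        ≡⟨ ≡.cong (λ k → suc (k + size ⊢s)) (≡.sym sᵣ) ⟩
  suc (size ⊢redex + size ⊢s)                    ∎)
  where open ≡.≡-Reasoning
-- The side condition that v be a value is not needed for expansion.
σ-root-expansion (σ₃ {v = v} _) π' with redex-inversion π'
... | redex-generation Γₜ Γᵤ P ⊢vs ⊢u env size≡ with app-inversion ⊢vs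
... | app-generation (Pᵥ ∷ Γᵥ) (Pₛ ∷ Γₛ) R ⊢shift-v ⊢s (p ∷ e) size≡ᵥₛ
  with anti-weaken v ⊢shift-v
... | pᵥ , ⊢v , sᵥ
  with redex ≈ᴱ-refl (convʰ (≈-sym (≈-trans p (≈-trans (⊎ᵗ-cong pᵥ ≈-refl) (⊎ᵗ-identityˡ Pₛ)))) ⊢s) ⊢u
... | ⊢redex , sᵣ =
  convᴱ (≈ᴱ-sym (≈ᴱ-trans env (≈ᴱ-trans (⊎ᴱ-cong e ≈ᴱ-refl) (⊎ᴱ-assoc Γᵥ Γₛ Γᵤ))))
        (app ⊢v ⊢redex) , (begin
  size π'                                        ≡⟨ size≡ ⟩
  suc (size ⊢vs + size ⊢u)                       ≡⟨ ≡.cong (λ k → suc (k + size ⊢u)) size≡ᵥₛ ⟩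
  suc (suc (size ⊢shift-v + size ⊢s) + size ⊢u)  ≡⟨ ≡.cong (λ k → suc (suc (k + size ⊢s) + size ⊢u)) sᵥ ⟩
  suc (suc (size ⊢v + size ⊢s) + size ⊢u)        ≡⟨ ≡.cong suc (+-assoc (suc (size ⊢v)) (size ⊢s) (size ⊢u)) ⟩
  suc (suc (size ⊢v + (size ⊢s + size ⊢u)))      ≡⟨ ≡.cong suc (≡.sym (+-suc (size ⊢v) (size ⊢s + size ⊢u))) ⟩
  suc (size ⊢v + suc (size ⊢s + size ⊢u))        ≡⟨ ≡.cong (λ k → suc (size ⊢v + k)) (≡.sym sᵣ) ⟩
  suc (size ⊢v + size ⊢redex)                    ∎)
  where open ≡.≡-Reasoning

module _ {R : ∀ {n} → Term n → Term n → Set} {_∼_ : ℕ → ℕ → Set}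
         (∼-refl : Reflexive _∼_) (+-mono : _+_ Preserves₂ _∼_ ⟶ _∼_ ⟶ _∼_)
         (root-expansion : ∀ {n} {t t' : Term n} → R t t' → ∀ {Γ Q} (π' : Γ ⊢ t' ∶ Q) →
                           Σ (Γ ⊢ t ∶ Q) λ π → size π' ∼ size π)
  where

  private
    app-mono : ∀ {a b c d} → a ∼ b → c ∼ d → suc (a + c) ∼ suc (b + d)
    app-mono p q = +-mono {1} {1} ∼-refl (+-mono p q)

  mutual
    Closure-expansion : ∀ {n} {t t' : Term n} → Closure R t t' → ∀ {Γ Q} (π' : Γ ⊢ t' ∶ Q) →
      Σ (Γ ⊢ t ∶ Q) λ π → size π' ∼ size π
    Closure-expansion (root r) π' = root-expansion r π'
    Closure-expansion (lam r) π' with lam-inversion π'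
    ... | lam-generation _ _ premises env type size≡ with Closure-expansionᴸ r premises
    ... | L , le = conv (≈ᴱ-sym env) type (lam L) , ≡.subst (_∼ sizes L) (≡.sym size≡) le
    Closure-expansion (appL r) π' with app-inversion π'
    ... | app-generation _ _ _ ⊢t ⊢u env size≡ with Closure-expansion r ⊢t
    ... | π , le = convᴱ (≈ᴱ-sym env) (app π ⊢u) ,
                   ≡.subst (_∼ _) (≡.sym size≡) (app-mono le ∼-refl)
    Closure-expansion (appR r) π' with app-inversion π'
    ... | app-generation _ _ _ ⊢t ⊢u env size≡ with Closure-expansion r ⊢u
    ... | π , le = convᴱ (≈ᴱ-sym env) (app ⊢t π) ,
                   ≡.subst (_∼ _) (≡.sym size≡) (app-mono ∼-refl le)

    Closure-expansionᴸ : ∀ {n} {t t' : Term (suc n)} → Closure R t t' → ∀ {Γ ps}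
      (L' : LamPremises Γ t' ps) → Σ (LamPremises Γ t ps) λ L → sizes L' ∼ sizes L
    Closure-expansionᴸ r []       = [] , ∼-refl
    Closure-expansionᴸ r (π' ∷ L') with Closure-expansion r π' | Closure-expansionᴸ r L'
    ... | π , le | L , le' = π ∷ L , +-mono le le'

βv-expansion : ∀ {n} {t t' : Term n} → t →βv t' → ∀ {Γ Q} (π' : Γ ⊢ t' ∶ Q) →
  Σ (Γ ⊢ t ∶ Q) λ π → size π' ≤ size π
βv-expansion = Closure-expansion {_∼_ = _≤_} ≤-refl +-mono-≤ βv-root-expansion

σ-expansion : ∀ {n} {t t' : Term n} → t →σ t' → ∀ {Γ Q} (π' : Γ ⊢ t' ∶ Q) →
  Σ (Γ ⊢ t ∶ Q) λ π → size π' ≡ size π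
σ-expansion = Closure-expansion {_∼_ = _≡_} refl (≡.cong₂ _+_) σ-root-expansion

mainTheorem19 : ∀ {n : ℕ} {t t' : Term n} {Γ : Env n} {Q : Ty} (π' : Γ ⊢ t' ∶ Q) →
    (t →βv t' → Σ (Γ ⊢ t ∶ Q) (λ π → size π' ≤ size π))
    × (t →σ t' → Σ (Γ ⊢ t ∶ Q) (λ π → size π ≡ size π'))
mainTheorem19 π' = (λ step → βv-expansion step π') , (λ step → map₂ ≡.sym (σ-expansion step π'))
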